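{- The reduction relation $\to_{\mathsf{x}'}$ is terminating on all $\mathsf{PTSC}\alpha$ terms and lists: there is no infinite $\to_{\mathsf{x}'}$-reduction sequence starting from any term or list.
   Context: Fix a set $\mathcal S$ of sorts ($s,s',\dots$), a denumerable set of variables ($x,y,z,\dots$), and two denumerable sets of meta-variables: term meta-variables $\alpha,\dots$ and list meta-variables $\beta,\dots$, each with a fixed arity $n\in\mathbb N$. Terms ($M,N,P,A,B,G,\dots$) and lists ($l,l',\dots$) of $\mathsf{PTSC}\alpha$ are given by $M ::= \Pi x^{A}.B \mid \lambda x^{A}.M \mid s \mid x\,l \mid M\,l \mid \langle N/x\rangle_A M \mid \alpha(M_1,\dots,M_n)$ and $l ::= [\,] \mid M\cdot l \mid l @ l' \mid \langle N/x\rangle_A l \mid \beta(M_1,\dots,M_n)$ ($n$ the arity of the meta-variable). $\Pi x^A.B$, $\lambda x^A.M$, $\langle N/x\rangle_A M$, $\langle N/x\rangle_A l$ bind $x$ in $B$, $M$, $M$, $l$ respectively; terms are taken up to $\alpha$-conversion. The system $\mathsf{x}'$ consists of the rules (capture-avoiding side conditions understood): (B1) $M\,[\,]\to M$; (B2) $(x\,l)\,l'\to x\,(l@l')$; (B3) $(M\,l)\,l'\to M\,(l@l')$; (A1) $(M\cdot l')@l\to M\cdot(l'@l)$; (A2) $[\,]@l\to l$; (A3) $(l@l')@l''\to l@(l'@l'')$; (A4) $l@[\,]\to l$; (C1) $\langle P/y\rangle_G(\lambda x^A.M)\to\lambda x^{\langle P/y\rangle_G A}.\langle P/y\rangle_G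 M$; (C2) $\langle P/y\rangle_G(y\,l)\to P\,(\langle P/y\rangle_G l)$; (C3) $\langle P/y\rangle_G(x\,l)\to x\,(\langle P/y\rangle_G l)$ if $x\neq y$; (C4) $\langle P/y\rangle_G(M\,l)\to(\langle P/y\rangle_G M)\,(\langle P/y\rangle_G l)$; (C5) $\langle P/y\rangle_G(\Pi x^A.B)\to\Pi x^{\langle P/y\rangle_G A}.\langle P/y\rangle_G B$; (C6) $\langle P/y\rangle_G s\to s$; (C$\alpha$) $\langle P/y\rangle_G\alpha(M_1,\dots,M_n)\to\alpha(\langle P/y\rangle_G M_1,\dots,\langle P/y\rangle_G M_n)$; (D1) $\langle P/y\rangle_G[\,]\to[\,]$; (D2) $\langle P/y\rangle_G(M\cdot l)\to(\langle P/y\rangle_G M)\cdot(\langle P/y\rangle_G l)$; (D3) $\langle P/y\rangle_G(l@l')\to(\langle P/y\rangle_G l)@(\langle P/y\rangle_G l')$; (D$\beta$) $\langle P/y\rangle_G\beta(M_1,\dots,M_n)\to\beta(\langle P/y\rangle_G M_1,\dots,\langle P/y\rangle_G M_n)$. $\to_{\mathsf{x}'}$ is the contextual closure of these rules. -}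

module Defs where

open import Data.Nat using (ℕ; zero; suc)
open import Data.Product using (∃)
open import Relation.Nullary using (¬_)

NoInfiniteSeq : {X : Set} → (X → X → Set) → Set
NoInfiniteSeq {X} _⟶_ = ¬ ∃ λ (f : ℕ → X) → ∀ i → f i ⟶ f (suc i)

-- Variables are de Bruijn indices (terms are thereby taken up to α-conversion).
-- A term meta-variable / list meta-variable is a name (ℕ) together with its
-- arity n; it is applied to exactly n arguments (Args n).
module PTSC (S : Set) where

  infixr 5 _∷_ _++_
  infix 4 _↦T_ _↦L_ _⟶T_ _⟶L_ _⟶A_

  mutual
    data Term : Set where
      Π    : Term → Term → Term
      ƛ    : Term → Term → Term
      srt  : S → Term
      var  : ℕ → Lst → Term
      app  : Term → Lst → Term
      sub  : Term → Term → Term → Term   -- sub N A M = ⟨N/x⟩_A M (binds x in M)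
      mvT  : ∀ {n} → ℕ → Args n → Term

    data Lst : Set where
      []   : Lst
      _∷_  : Term → Lst → Lst
      _++_  : Lst → Lst → Lst
      subL : Term → Term → Lst → Lst     -- ⟨N/x⟩_A l  (binds x in l)
      mvL  : ∀ {n} → ℕ → Args n → Lst

    data Args : ℕ → Set where
      []  : Args zero
      _∷_ : ∀ {n} → Term → Args n → Args (suc n)

  ext : (ℕ → ℕ) → ℕ → ℕ
  ext ρ zero    = zero
  ext ρ (suc x) = suc (ρ x)

  mutual
    ren : (ℕ → ℕ) → Term → Term
    ren ρ (Π A B)     = Π (ren ρ A) (ren (ext ρ) B)
    ren ρ (ƛ A M)     = ƛ (ren ρ A) (ren (ext ρ) M)
    ren ρ (srt s)     = srt s
    ren ρ (var x l)   = var (ρ x) (renL ρ l)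
    ren ρ (app M l)   = app (ren ρ M) (renL ρ l)
    ren ρ (sub N A M) = sub (ren ρ N) (ren ρ A) (ren (ext ρ) M)
    ren ρ (mvT a Ms)  = mvT a (renA ρ Ms)

    renL : (ℕ → ℕ) → Lst → Lst
    renL ρ []           = []
    renL ρ (M ∷ l)      = ren ρ M ∷ renL ρ l
    renL ρ (l ++ l')     = renL ρ l ++ renL ρ l'
    renL ρ (subL N A l) = subL (ren ρ N) (ren ρ A) (renL (ext ρ) l)
    renL ρ (mvL b Ms)   = mvL b (renA ρ Ms)

    renA : ∀ {n} → (ℕ → ℕ) → Args n → Args n
    renA ρ []       = []
    renA ρ (M ∷ Ms) = ren ρ M ∷ renA ρ Ms

  ↑ : Term → Term
  ↑ = ren suc

  swap01 : ℕ → ℕ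
  swap01 zero          = suc zero
  swap01 (suc zero)    = zero
  swap01 (suc (suc x)) = suc (suc x)

  subA : ∀ {n} → Term → Term → Args n → Args n
  subA P G []       = []
  subA P G (M ∷ Ms) = sub P G M ∷ subA P G Ms

  data _↦T_ : Term → Term → Set where
    B1 : ∀ {M} → app M [] ↦T M
    B2 : ∀ {x l l'} → app (var x l) l' ↦T var x (l ++ l')
    B3 : ∀ {M l l'} → app (app M l) l' ↦T app M (l ++ l')
    C1 : ∀ {P G A M} →
         sub P G (ƛ A M) ↦T ƛ (sub P G A) (sub (↑ P) (↑ G) (ren swap01 M))
    C2 : ∀ {P G l} → sub P G (var zero l) ↦T app P (subL P G l)
    C3 : ∀ {P G x l} → sub P G (var (suc x) l) ↦T var x (subL P G l)
    C4 : ∀ {P G M l} → sub P G (app M l) ↦T app (sub P G M) (subL P G l)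
    C5 : ∀ {P G A B} →
         sub P G (Π A B) ↦T Π (sub P G A) (sub (↑ P) (↑ G) (ren swap01 B))
    C6 : ∀ {P G s} → sub P G (srt s) ↦T srt s
    Cα : ∀ {P G n a} {Ms : Args n} → sub P G (mvT a Ms) ↦T mvT a (subA P G Ms)

  data _↦L_ : Lst → Lst → Set where
    A1 : ∀ {M l' l} → (M ∷ l') ++ l ↦L M ∷ (l' ++ l)
    A2 : ∀ {l} → [] ++ l ↦L l
    A3 : ∀ {l l' l''} → (l ++ l') ++ l'' ↦L l ++ (l' ++ l'')
    A4 : ∀ {l} → l ++ [] ↦L l
    D1 : ∀ {P G} → subL P G [] ↦L []
    D2 : ∀ {P G M l} → subL P G (M ∷ l) ↦L (sub P G M ∷ subL P G l)
    D3 : ∀ {P G l l'} → subL P G (l ++ l') ↦L (subL P G l ++ subL P G l')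
    Dβ : ∀ {P G n b} {Ms : Args n} → subL P G (mvL b Ms) ↦L mvL b (subA P G Ms)

  mutual
    data _⟶T_ : Term → Term → Set where
      root  : ∀ {M N} → M ↦T N → M ⟶T N
      Π₁    : ∀ {A A' B} → A ⟶T A' → Π A B ⟶T Π A' B
      Π₂    : ∀ {A B B'} → B ⟶T B' → Π A B ⟶T Π A B'
      ƛ₁    : ∀ {A A' M} → A ⟶T A' → ƛ A M ⟶T ƛ A' M
      ƛ₂    : ∀ {A M M'} → M ⟶T M' → ƛ A M ⟶T ƛ A M'
      var₁  : ∀ {x l l'} → l ⟶L l' → var x l ⟶T var x l'
      app₁  : ∀ {M M' l} → M ⟶T M' → app M l ⟶T app M' l
      app₂  : ∀ {M l l'} → l ⟶L l' → app M l ⟶T app M l'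
      sub₁  : ∀ {N N' A M} → N ⟶T N' → sub N A M ⟶T sub N' A M
      sub₂  : ∀ {N A A' M} → A ⟶T A' → sub N A M ⟶T sub N A' M
      sub₃  : ∀ {N A M M'} → M ⟶T M' → sub N A M ⟶T sub N A M'
      mvT₁  : ∀ {n a} {Ms Ms' : Args n} → Ms ⟶A Ms' → mvT a Ms ⟶T mvT a Ms'

    data _⟶L_ : Lst → Lst → Set where
      root  : ∀ {l l'} → l ↦L l' → l ⟶L l'
      ∷₁    : ∀ {M M' l} → M ⟶T M' → (M ∷ l) ⟶L (M' ∷ l)
      ∷₂    : ∀ {M l l'} → l ⟶L l' → (M ∷ l) ⟶L (M ∷ l')
      ++₁    : ∀ {l₁ l₁' l₂} → l₁ ⟶L l₁' → (l₁ ++ l₂) ⟶L (l₁' ++ l₂)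
      ++₂    : ∀ {l₁ l₂ l₂'} → l₂ ⟶L l₂' → (l₁ ++ l₂) ⟶L (l₁ ++ l₂')
      subL₁ : ∀ {N N' A l} → N ⟶T N' → subL N A l ⟶L subL N' A l
      subL₂ : ∀ {N A A' l} → A ⟶T A' → subL N A l ⟶L subL N A' l
      subL₃ : ∀ {N A l l'} → l ⟶L l' → subL N A l ⟶L subL N A l'
      mvL₁  : ∀ {n b} {Ms Ms' : Args n} → Ms ⟶A Ms' → mvL b Ms ⟶L mvL b Ms'

    data _⟶A_ : ∀ {n} → Args n → Args n → Set where
      hd : ∀ {n M M'} {Ms : Args n} → M ⟶T M' → (M ∷ Ms) ⟶A (M' ∷ Ms)
      tl : ∀ {n M} {Ms Ms' : Args n} → Ms ⟶A Ms' → (M ∷ Ms) ⟶A (M ∷ Ms')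

module Submission where

-- Termination of x' by a strictly monotone interpretation into ℕ.
--
-- Every term, list and argument vector is sent to a natural number so that
-- each root rule of x' strictly decreases the value and every syntactic
-- constructor is strictly monotone in each argument; hence every
-- x'-step, at any depth, strictly decreases the value, and a reduction
-- sequence cannot be infinite.  The interpretation is built from
--   pair a b     = 1 + a + b          for Π, λ and cons,
--   node a b     = 1 + 2a + b         for application and @ (weighting the
--                                     left operand makes B2, B3, A1, A3 decrease),
--   scaled p g n = (2 + 2p + g) · n   for explicit substitution ⟨P/y⟩_G,
-- so pushing a substitution through a constructor (rules C and D) trades one
-- factor 2 + 2p + g for copies of P and G that cost less, even when P itself
-- is released by C2.

open import Defs
open import Data.Nat
  using (ℕ; suc; _+_; _*_; _<_; z≤n; s≤s; NonZero)
open import Data.Nat.Properties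
open import Data.Nat.Induction using (<-wellFounded)
open import Data.Nat.Tactic.RingSolver using (solve-∀)
open import Data.Product using (_×_; _,_)
open import Data.Empty using (⊥)
open import Function using (_∘_)
open import Induction.WellFounded using (Acc; acc)
open import Relation.Binary.PropositionalEquality
  using (_≡_; refl; sym; subst; cong; cong₂; module ≡-Reasoning)

decreasing-measure⇒noInfiniteSeq :
  {X : Set} (_⟶_ : X → X → Set) (μ : X → ℕ) →
  (∀ {a b} → a ⟶ b → μ b < μ a) → NoInfiniteSeq _⟶_
decreasing-measure⇒noInfiniteSeq {X} _⟶_ μ decreases (f , chain) =
  noChainFrom f (<-wellFounded (μ (f 0))) chain
  where
  noChainFrom : (g : ℕ → X) → Acc _<_ (μ (g 0)) →
                (∀ i → g i ⟶ g (suc i)) → ⊥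
  noChainFrom g (acc smaller) steps =
    noChainFrom (g ∘ suc) (smaller (decreases (steps 0))) (steps ∘ suc)

<-by-gap : ∀ {a b} d → a + suc d ≡ b → a < b
<-by-gap {a} d eq = subst (a <_) eq (m<m+n a (s≤s z≤n))

pair : ℕ → ℕ → ℕ
pair a b = suc (a + b)

node : ℕ → ℕ → ℕ
node a b = suc (2 * a + b)

weight : ℕ → ℕ → ℕ
weight p g = suc (suc (2 * p + g))

scaled : ℕ → ℕ → ℕ → ℕ
scaled p g n = weight p g * n

node-assoc : ∀ a b c → node a (node b c) < node (node a b) c
node-assoc a b c = <-by-gap (2 * a) (eq a b c)
  where
  eq : ∀ a b c → suc (2 * a + suc (2 * b + c)) + suc (2 * a)
               ≡ suc (2 * suc (2 * a + b) + c)
  eq = solve-∀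

-- A1, and B2 as its instance m = 0 (a variable x l counts as pair 0 l).
node-pair : ∀ m a b → pair m (node a b) < node (pair m a) b
node-pair m a b = <-by-gap m (eq m a b)
  where
  eq : ∀ m a b → suc (m + suc (2 * a + b)) + suc m ≡ suc (2 * suc (m + a) + b)
  eq = solve-∀

node-unitʳ : ∀ a → a < node a 1
node-unitʳ a = <-by-gap (suc a) (eq a)
  where
  eq : ∀ a → a + suc (suc a) ≡ suc (2 * a + 1)
  eq = solve-∀

node-unitˡ : ∀ b → b < node 1 b
node-unitˡ b = <-by-gap 2 (+-comm b 3)

-- Inequalities for the rules C and D.  All of them follow from
-- weight · (1 + n) = weight + weight · n.
scaled-suc-> : ∀ {c} p g n → c < weight p g → c + scaled p g n < scaled p g (suc n)
scaled-suc-> {c} p g n c<w =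
  subst (c + scaled p g n <_) (sym (*-suc (weight p g) n))
        (+-monoˡ-< (scaled p g n) c<w)

scaled-suc : ∀ p g n → suc (scaled p g n) < scaled p g (suc n)
scaled-suc p g n = scaled-suc-> p g n (s≤s (s≤s z≤n))

scaled-one : ∀ p g → 1 < scaled p g 1
scaled-one p g =
  subst (λ x → suc x < scaled p g 1) (*-zeroʳ (weight p g)) (scaled-suc p g 0)

scaled-pair : ∀ p g a b → pair (scaled p g a) (scaled p g b) < scaled p g (pair a b)
scaled-pair p g a b =
  subst (_< scaled p g (pair a b)) (cong suc (*-distribˡ-+ (weight p g) a b))
        (scaled-suc p g (a + b))

scaled-node : ∀ p g a b → node (scaled p g a) (scaled p g b) < scaled p g (node a b)
scaled-node p g a b =
  subst (_< scaled p g (node a b)) (cong suc (eq (weight p g) a b))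
        (scaled-suc p g (2 * a + b))
  where
  eq : ∀ k a b → k * (2 * a + b) ≡ 2 * (k * a) + k * b
  eq = solve-∀

-- C2: the substitution releases its body P; this is paid for by the
-- summand 2p of the weight.
scaled-release : ∀ p g n → node p (scaled p g n) < scaled p g (suc n)
scaled-release p g n = scaled-suc-> p g n (s≤s (s≤s (m≤m+n (2 * p) g)))

pair-monoˡ : ∀ {a a'} b → a' < a → pair a' b < pair a b
pair-monoˡ b lt = s≤s (+-monoˡ-< b lt)

pair-monoʳ : ∀ a {b b'} → b' < b → pair a b' < pair a b
pair-monoʳ a lt = s≤s (+-monoʳ-< a lt)

node-monoˡ : ∀ {a a'} b → a' < a → node a' b < node a b
node-monoˡ b lt = s≤s (+-monoˡ-< b (*-monoʳ-< 2 lt))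

node-monoʳ : ∀ a {b b'} → b' < b → node a b' < node a b
node-monoʳ a lt = s≤s (+-monoʳ-< (2 * a) lt)

scaled-monoᵖ : ∀ {p p'} g n .{{_ : NonZero n}} → p' < p → scaled p' g n < scaled p g n
scaled-monoᵖ g n lt = *-monoˡ-< n (s≤s (s≤s (+-monoˡ-< g (*-monoʳ-< 2 lt))))

scaled-monoᵍ : ∀ p {g g'} n .{{_ : NonZero n}} → g' < g → scaled p g' n < scaled p g n
scaled-monoᵍ p n lt = *-monoˡ-< n (s≤s (s≤s (+-monoʳ-< (2 * p) lt)))

scaled-monoⁿ : ∀ p g {n n'} → n' < n → scaled p g n' < scaled p g n
scaled-monoⁿ p g lt = *-monoʳ-< (weight p g) lt

module Interpretation (S : Set) where
  open PTSC S

  mutual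
    ⟦_⟧T : Term → ℕ
    ⟦ Π A B ⟧T     = pair ⟦ A ⟧T ⟦ B ⟧T
    ⟦ ƛ A M ⟧T     = pair ⟦ A ⟧T ⟦ M ⟧T
    ⟦ srt s ⟧T     = 1
    ⟦ var x l ⟧T   = suc ⟦ l ⟧L
    ⟦ app M l ⟧T   = node ⟦ M ⟧T ⟦ l ⟧L
    ⟦ sub P G M ⟧T = scaled ⟦ P ⟧T ⟦ G ⟧T ⟦ M ⟧T
    ⟦ mvT a Ms ⟧T  = suc ⟦ Ms ⟧A

    ⟦_⟧L : Lst → ℕ
    ⟦ [] ⟧L         = 1
    ⟦ M ∷ l ⟧L      = pair ⟦ M ⟧T ⟦ l ⟧L
    ⟦ l ++ l' ⟧L    = node ⟦ l ⟧L ⟦ l' ⟧L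
    ⟦ subL P G l ⟧L = scaled ⟦ P ⟧T ⟦ G ⟧T ⟦ l ⟧L
    ⟦ mvL b Ms ⟧L   = suc ⟦ Ms ⟧A

    ⟦_⟧A : ∀ {n} → Args n → ℕ
    ⟦ [] ⟧A     = 0
    ⟦ M ∷ Ms ⟧A = ⟦ M ⟧T + ⟦ Ms ⟧A

  -- Terms and lists are never interpreted by 0; this makes substitution
  -- strictly monotone in the substituted term and in its type.
  mutual
    ⟦⟧T-nonZero : ∀ M → NonZero ⟦ M ⟧T
    ⟦⟧T-nonZero (Π A B)     = _
    ⟦⟧T-nonZero (ƛ A M)     = _
    ⟦⟧T-nonZero (srt s)     = _
    ⟦⟧T-nonZero (var x l)   = _
    ⟦⟧T-nonZero (app M l)   = _
    ⟦⟧T-nonZero (sub P G M) =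
      m*n≢0 (weight ⟦ P ⟧T ⟦ G ⟧T) ⟦ M ⟧T {{_}} {{⟦⟧T-nonZero M}}
    ⟦⟧T-nonZero (mvT a Ms)  = _

    ⟦⟧L-nonZero : ∀ l → NonZero ⟦ l ⟧L
    ⟦⟧L-nonZero []           = _
    ⟦⟧L-nonZero (M ∷ l)      = _
    ⟦⟧L-nonZero (l ++ l')    = _
    ⟦⟧L-nonZero (subL P G l) =
      m*n≢0 (weight ⟦ P ⟧T ⟦ G ⟧T) ⟦ l ⟧L {{_}} {{⟦⟧L-nonZero l}}
    ⟦⟧L-nonZero (mvL b Ms)   = _

  -- Renaming does not change the interpretation (needed for C1, C5, where
  -- the substitution is shifted under the binder).
  mutual
    ren-invariant : ∀ ρ M → ⟦ ren ρ M ⟧T ≡ ⟦ M ⟧T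
    ren-invariant ρ (Π A B)     = cong₂ pair (ren-invariant ρ A) (ren-invariant (ext ρ) B)
    ren-invariant ρ (ƛ A M)     = cong₂ pair (ren-invariant ρ A) (ren-invariant (ext ρ) M)
    ren-invariant ρ (srt s)     = refl
    ren-invariant ρ (var x l)   = cong suc (renL-invariant ρ l)
    ren-invariant ρ (app M l)   = cong₂ node (ren-invariant ρ M) (renL-invariant ρ l)
    ren-invariant ρ (sub N A M) =
      cong₂ _*_ (cong₂ weight (ren-invariant ρ N) (ren-invariant ρ A))
                (ren-invariant (ext ρ) M)
    ren-invariant ρ (mvT a Ms)  = cong suc (renA-invariant ρ Ms)

    renL-invariant : ∀ ρ l → ⟦ renL ρ l ⟧L ≡ ⟦ l ⟧L
    renL-invariant ρ []           = refl
    renL-invariant ρ (M ∷ l)      = cong₂ pair (ren-invariant ρ M) (renL-invariant ρ l)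
    renL-invariant ρ (l ++ l')    = cong₂ node (renL-invariant ρ l) (renL-invariant ρ l')
    renL-invariant ρ (subL N A l) =
      cong₂ _*_ (cong₂ weight (ren-invariant ρ N) (ren-invariant ρ A))
                (renL-invariant (ext ρ) l)
    renL-invariant ρ (mvL b Ms)   = cong suc (renA-invariant ρ Ms)

    renA-invariant : ∀ {n} ρ (Ms : Args n) → ⟦ renA ρ Ms ⟧A ≡ ⟦ Ms ⟧A
    renA-invariant ρ []       = refl
    renA-invariant ρ (M ∷ Ms) = cong₂ _+_ (ren-invariant ρ M) (renA-invariant ρ Ms)

  subA-scaled : ∀ {n} P G (Ms : Args n) →
                ⟦ subA P G Ms ⟧A ≡ scaled ⟦ P ⟧T ⟦ G ⟧T ⟦ Ms ⟧A
  subA-scaled P G []       = sym (*-zeroʳ (weight ⟦ P ⟧T ⟦ G ⟧T))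
  subA-scaled P G (M ∷ Ms) = begin
    scaled p g ⟦ M ⟧T + ⟦ subA P G Ms ⟧A    ≡⟨ cong (scaled p g ⟦ M ⟧T +_) (subA-scaled P G Ms) ⟩
    scaled p g ⟦ M ⟧T + scaled p g ⟦ Ms ⟧A  ≡⟨ *-distribˡ-+ (weight p g) ⟦ M ⟧T ⟦ Ms ⟧A ⟨
    scaled p g (⟦ M ⟧T + ⟦ Ms ⟧A)           ∎
    where
    open ≡-Reasoning
    p g : ℕ
    p = ⟦ P ⟧T
    g = ⟦ G ⟧T

  root-decreasesT : ∀ {M N} → M ↦T N → ⟦ N ⟧T < ⟦ M ⟧T
  root-decreasesT (B1 {M})                = node-unitʳ ⟦ M ⟧T
  root-decreasesT (B2 {l = l} {l'})       = node-pair 0 ⟦ l ⟧L ⟦ l' ⟧L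
  root-decreasesT (B3 {M} {l} {l'})       = node-assoc ⟦ M ⟧T ⟦ l ⟧L ⟦ l' ⟧L
  root-decreasesT (C1 {P} {G} {A} {M})
    rewrite ren-invariant suc P | ren-invariant suc G | ren-invariant swap01 M =
    scaled-pair ⟦ P ⟧T ⟦ G ⟧T ⟦ A ⟧T ⟦ M ⟧T
  root-decreasesT (C2 {P} {G} {l})        = scaled-release ⟦ P ⟧T ⟦ G ⟧T ⟦ l ⟧L
  root-decreasesT (C3 {P} {G} {l = l})    = scaled-suc ⟦ P ⟧T ⟦ G ⟧T ⟦ l ⟧L
  root-decreasesT (C4 {P} {G} {M} {l})    = scaled-node ⟦ P ⟧T ⟦ G ⟧T ⟦ M ⟧T ⟦ l ⟧L
  root-decreasesT (C5 {P} {G} {A} {B})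
    rewrite ren-invariant suc P | ren-invariant suc G | ren-invariant swap01 B =
    scaled-pair ⟦ P ⟧T ⟦ G ⟧T ⟦ A ⟧T ⟦ B ⟧T
  root-decreasesT (C6 {P} {G})            = scaled-one ⟦ P ⟧T ⟦ G ⟧T
  root-decreasesT (Cα {P} {G} {Ms = Ms}) rewrite subA-scaled P G Ms =
    scaled-suc ⟦ P ⟧T ⟦ G ⟧T ⟦ Ms ⟧A

  root-decreasesL : ∀ {l l'} → l ↦L l' → ⟦ l' ⟧L < ⟦ l ⟧L
  root-decreasesL (A1 {M} {l'} {l})       = node-pair ⟦ M ⟧T ⟦ l' ⟧L ⟦ l ⟧L
  root-decreasesL (A2 {l})                = node-unitˡ ⟦ l ⟧L
  root-decreasesL (A3 {l} {l'} {l''})     = node-assoc ⟦ l ⟧L ⟦ l' ⟧L ⟦ l'' ⟧L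
  root-decreasesL (A4 {l})                = node-unitʳ ⟦ l ⟧L
  root-decreasesL (D1 {P} {G})            = scaled-one ⟦ P ⟧T ⟦ G ⟧T
  root-decreasesL (D2 {P} {G} {M} {l})    = scaled-pair ⟦ P ⟧T ⟦ G ⟧T ⟦ M ⟧T ⟦ l ⟧L
  root-decreasesL (D3 {P} {G} {l} {l'})   = scaled-node ⟦ P ⟧T ⟦ G ⟧T ⟦ l ⟧L ⟦ l' ⟧L
  root-decreasesL (Dβ {P} {G} {Ms = Ms}) rewrite subA-scaled P G Ms =
    scaled-suc ⟦ P ⟧T ⟦ G ⟧T ⟦ Ms ⟧A

  mutual
    decreasesT : ∀ {M N} → M ⟶T N → ⟦ N ⟧T < ⟦ M ⟧T
    decreasesT (root r)               = root-decreasesT r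
    decreasesT (Π₁ {B = B} r)         = pair-monoˡ ⟦ B ⟧T (decreasesT r)
    decreasesT (Π₂ {A = A} r)         = pair-monoʳ ⟦ A ⟧T (decreasesT r)
    decreasesT (ƛ₁ {M = M} r)         = pair-monoˡ ⟦ M ⟧T (decreasesT r)
    decreasesT (ƛ₂ {A = A} r)         = pair-monoʳ ⟦ A ⟧T (decreasesT r)
    decreasesT (var₁ r)               = s≤s (decreasesL r)
    decreasesT (app₁ {l = l} r)       = node-monoˡ ⟦ l ⟧L (decreasesT r)
    decreasesT (app₂ {M = M} r)       = node-monoʳ ⟦ M ⟧T (decreasesL r)
    decreasesT (sub₁ {A = A} {M = M} r) =
      scaled-monoᵖ ⟦ A ⟧T ⟦ M ⟧T {{⟦⟧T-nonZero M}} (decreasesT r)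
    decreasesT (sub₂ {N = N} {M = M} r) =
      scaled-monoᵍ ⟦ N ⟧T ⟦ M ⟧T {{⟦⟧T-nonZero M}} (decreasesT r)
    decreasesT (sub₃ {N = N} {A = A} r) = scaled-monoⁿ ⟦ N ⟧T ⟦ A ⟧T (decreasesT r)
    decreasesT (mvT₁ r)               = s≤s (decreasesA r)

    decreasesL : ∀ {l l'} → l ⟶L l' → ⟦ l' ⟧L < ⟦ l ⟧L
    decreasesL (root r)               = root-decreasesL r
    decreasesL (∷₁ {l = l} r)         = pair-monoˡ ⟦ l ⟧L (decreasesT r)
    decreasesL (∷₂ {M = M} r)         = pair-monoʳ ⟦ M ⟧T (decreasesL r)
    decreasesL (++₁ {l₂ = l₂} r)      = node-monoˡ ⟦ l₂ ⟧L (decreasesL r)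
    decreasesL (++₂ {l₁ = l₁} r)      = node-monoʳ ⟦ l₁ ⟧L (decreasesL r)
    decreasesL (subL₁ {A = A} {l = l} r) =
      scaled-monoᵖ ⟦ A ⟧T ⟦ l ⟧L {{⟦⟧L-nonZero l}} (decreasesT r)
    decreasesL (subL₂ {N = N} {l = l} r) =
      scaled-monoᵍ ⟦ N ⟧T ⟦ l ⟧L {{⟦⟧L-nonZero l}} (decreasesT r)
    decreasesL (subL₃ {N = N} {A = A} r) = scaled-monoⁿ ⟦ N ⟧T ⟦ A ⟧T (decreasesL r)
    decreasesL (mvL₁ r)               = s≤s (decreasesA r)

    decreasesA : ∀ {n} {Ms Ms' : Args n} → Ms ⟶A Ms' → ⟦ Ms' ⟧A < ⟦ Ms ⟧A
    decreasesA (hd {Ms = Ms} r) = +-monoˡ-< ⟦ Ms ⟧A (decreasesT r)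
    decreasesA (tl {M = M} r)   = +-monoʳ-< ⟦ M ⟧T (decreasesA r)

corollary1p3 : (S : Set) → NoInfiniteSeq (PTSC._⟶T_ S) × NoInfiniteSeq (PTSC._⟶L_ S)
corollary1p3 S =
    decreasing-measure⇒noInfiniteSeq (PTSC._⟶T_ S) ⟦_⟧T decreasesT
  , decreasing-measure⇒noInfiniteSeq (PTSC._⟶L_ S) ⟦_⟧L decreasesL
  where open Interpretation S
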